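{- Let $p$ be a prime, $\Gamma$ a congruence subgroup of $\mathrm{SL}_2(\mathbb{Z})$ of level a power of $p$, and $s_1,s_2\ge1$. If $M_1\in V_{s_1}$ and $M_2\in V_{s_2}$, then $M_1M_2-M_2M_1\in V_{s_1+s_2}$.
   Context: For $s\ge1$, $G_s$ is the image of $\Gamma$ in $\mathrm{SL}_2(\mathbb{Z}/p^s\mathbb{Z})$ and $K_{s+1}$ the kernel of the reduction $G_{s+1}\to G_s$. With $\exp_{1,s}:\mathfrak{sl}_2(\mathbb{F}_p)\to\mathrm{SL}_2(\mathbb{Z}/p^{s+1}\mathbb{Z})$, $A\mapsto I+p^s\widetilde A$ ($\widetilde A$ any lift), $V_s=\exp_{1,s}^{ -1}(K_{s+1})\subseteq\mathfrak{sl}_2(\mathbb{F}_p)$, where $\mathfrak{sl}_2(\mathbb{F}_p)$ is the space of traceless $2\times2$ matrices over $\mathbb{F}_p$. -}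

module Defs where

open import Data.Nat using (ℕ; _^_)
open import Data.Integer using (ℤ; +_; _+_; _-_; _*_; -_; 0ℤ; 1ℤ)
open import Data.Integer.Divisibility using (_∣_)
open import Relation.Binary.PropositionalEquality using (_≡_)
open import Data.Product using (Σ; _×_)

record M2 : Set where
  constructor mat
  field
    a b c d : ℤ
open M2 public

infixl 7 _·_
_·_ : M2 → M2 → M2
mat a₁ b₁ c₁ d₁ · mat a₂ b₂ c₂ d₂ =
  mat (a₁ * a₂ + b₁ * c₂) (a₁ * b₂ + b₁ * d₂)
      (c₁ * a₂ + d₁ * c₂) (c₁ * b₂ + d₁ * d₂)

_⊕_ : M2 → M2 → M2
mat a₁ b₁ c₁ d₁ ⊕ mat a₂ b₂ c₂ d₂ = mat (a₁ + a₂) (b₁ + b₂) (c₁ + c₂) (d₁ + d₂)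

_⊖_ : M2 → M2 → M2
mat a₁ b₁ c₁ d₁ ⊖ mat a₂ b₂ c₂ d₂ = mat (a₁ - a₂) (b₁ - b₂) (c₁ - c₂) (d₁ - d₂)

_⋆_ : ℤ → M2 → M2
k ⋆ mat a₁ b₁ c₁ d₁ = mat (k * a₁) (k * b₁) (k * c₁) (k * d₁)

I₂ : M2
I₂ = mat 1ℤ 0ℤ 0ℤ 1ℤ

det : M2 → ℤ
det (mat a₁ b₁ c₁ d₁) = a₁ * d₁ - b₁ * c₁

tr : M2 → ℤ
tr (mat a₁ b₁ c₁ d₁) = a₁ + d₁

-- adjugate; the inverse of a determinant-one matrix
adj : M2 → M2
adj (mat a₁ b₁ c₁ d₁) = mat d₁ (- b₁) (- c₁) a₁

_≡_[mod_] : ℤ → ℤ → ℕ → Set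
x ≡ y [mod n ] = (+ n) ∣ (x - y)

_≡ₘ_[mod_] : M2 → M2 → ℕ → Set
g ≡ₘ h [mod n ] =
  (a g ≡ a h [mod n ]) × (b g ≡ b h [mod n ]) ×
  (c g ≡ c h [mod n ]) × (d g ≡ d h [mod n ])

SL₂ℤ : M2 → Set
SL₂ℤ g = det g ≡ 1ℤ

record IsCongruenceSubgroupPPower (p : ℕ) (Γ : M2 → Set) : Set where
  field
    ⊆SL₂   : ∀ g → Γ g → SL₂ℤ g
    has-I  : Γ I₂
    closed-· : ∀ g h → Γ g → Γ h → Γ (g · h)
    closed-⁻¹ : ∀ g → Γ g → Γ (adj g)
    k : ℕ
    ⊇Γ[pᵏ] : ∀ g → SL₂ℤ g → g ≡ₘ I₂ [mod p ^ k ] → Γ g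

-- Elements of sl₂(𝔽_p) are represented by integer matrices (entries read
-- mod p) with trace ≡ 0 mod p.  A ∈ V_s iff I + p^s Ã lies in K_{s+1},
-- i.e. iff some γ ∈ Γ reduces mod p^{s+1} to I + p^s Ã.  (Any element of
-- G_{s+1} congruent to I + p^s Ã is automatically ≡ I mod p^s, so lies in
-- K_{s+1}; the condition is independent of the integer lift Ã.)
sl₂𝔽 : ℕ → M2 → Set
sl₂𝔽 p A = tr A ≡ 0ℤ [mod p ]

V : ℕ → (M2 → Set) → ℕ → M2 → Set
V p Γ s A = sl₂𝔽 p A ×
  Σ M2 (λ γ → Γ γ × (γ ≡ₘ (I₂ ⊕ ((+ (p ^ s)) ⋆ A)) [mod p ^ (ℕ.suc s) ]))
  where import Data.Nat as ℕ

-- Write γᵢ = I + p^sᵢ Xᵢ with Xᵢ ≡ Mᵢ (mod p). As det γᵢ = 1 the group commutator is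
-- γ₁γ₂γ₁⁻¹γ₂⁻¹ = I + (γ₁γ₂ − γ₂γ₁)γ₁⁻¹γ₂⁻¹ = I + p^(s₁+s₂) [X₁,X₂] γ₁⁻¹γ₂⁻¹, and since sᵢ ≥ 1
-- gives γᵢ⁻¹ ≡ I (mod p), it is ≡ I + p^(s₁+s₂) [M₁,M₂] (mod p^(s₁+s₂+1)). It lies in Γ, and the
-- trace of a commutator vanishes identically.
module Submission where

open import Defs
open import Data.Nat as ℕ using (ℕ; suc; _≥_; s≤s; z≤n)
open import Data.Nat.Properties using (^-distribˡ-+-*)
open import Data.Nat.Divisibility as ℕᵈ using (_∣_; _∣0; m∣m*n)
open import Data.Nat.Primality using (Prime)
open import Data.Integer using (ℤ; +_; _+_; _-_; _*_; -_; 0ℤ; 1ℤ)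
open import Data.Integer.Properties using (+-inverseʳ; pos-*)
open import Data.Integer.Divisibility.Signed as Signed
  using (divides; ∣ᵤ⇒∣; ∣⇒∣ᵤ; ∣m∣n⇒∣m+n; ∣m⇒∣-m; ∣n⇒∣m*n; ∣m⇒∣m*n)
open import Data.Integer.Tactic.RingSolver using (solve-∀; ring)
open import Tactic.RingSolver.NonReflective ring using (Expr; Κ; Ι; ⊝_; _⊗_; module Ops)
  renaming (_⊕_ to _⊕ᴱ_)
open import Data.Fin using (Fin; #_)
open import Data.Vec using (Vec; _∷_; [])
open import Data.Product using (Σ; _×_; _,_)
open import Relation.Binary.PropositionalEquality

infix 4 _≡_⟨mod_⟩

-- Unlike the congruences of Defs, which unfold to divisibility of a difference, these records
-- keep both sides recoverable from the type, so implicit arguments can be inferred.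
record _≡_⟨mod_⟩ (x y : ℤ) (n : ℕ) : Set where
  constructor ⟨_⟩
  field difference : Signed._∣_ (+ n) (x - y)

module _ {n : ℕ} where

  ≡-refl : ∀ x → x ≡ x ⟨mod n ⟩
  ≡-refl x = ⟨ divides 0ℤ (+-inverseʳ x) ⟩

  +-cong : ∀ {x x′ y y′} → x ≡ x′ ⟨mod n ⟩ → y ≡ y′ ⟨mod n ⟩ → x + y ≡ x′ + y′ ⟨mod n ⟩
  +-cong {x} {x′} {y} {y′} ⟨ n∣x-x′ ⟩ ⟨ n∣y-y′ ⟩ =
    ⟨ subst (Signed._∣_ (+ n)) (split x x′ y y′) (∣m∣n⇒∣m+n n∣x-x′ n∣y-y′) ⟩
    where
    split : ∀ x x′ y y′ → (x - x′) + (y - y′) ≡ (x + y) - (x′ + y′)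
    split = solve-∀

  -‿cong : ∀ {x y} → x ≡ y ⟨mod n ⟩ → - x ≡ - y ⟨mod n ⟩
  -‿cong {x} {y} ⟨ n∣x-y ⟩ = ⟨ subst (Signed._∣_ (+ n)) (split x y) (∣m⇒∣-m n∣x-y) ⟩
    where
    split : ∀ x y → - (x - y) ≡ (- x) - (- y)
    split = solve-∀

  *-cong : ∀ {x x′ y y′} → x ≡ x′ ⟨mod n ⟩ → y ≡ y′ ⟨mod n ⟩ → x * y ≡ x′ * y′ ⟨mod n ⟩
  *-cong {x} {x′} {y} {y′} ⟨ n∣x-x′ ⟩ ⟨ n∣y-y′ ⟩ =
    ⟨ subst (Signed._∣_ (+ n)) (split x x′ y y′) (∣m∣n⇒∣m+n (∣n⇒∣m*n x n∣y-y′) (∣m⇒∣m*n y′ n∣x-x′)) ⟩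
    where
    split : ∀ x x′ y y′ → x * (y - y′) + (x - x′) * y′ ≡ x * y - x′ * y′
    split = solve-∀

  +-multiple-≡ : ∀ {e} → n ∣ e → ∀ x y → x + + e * y ≡ x ⟨mod n ⟩
  +-multiple-≡ {e} (ℕᵈ.divides q refl) x y = ⟨ divides (+ q * y) (begin
    x + + (q ℕ.* n) * y - x   ≡⟨ cong (λ k → x + k * y - x) (pos-* q n) ⟩
    x + + q * + n * y - x     ≡⟨ split x (+ q) (+ n) y ⟩
    + q * y * + n             ∎) ⟩
    where
    open ≡-Reasoning
    split : ∀ x q n y → x + q * n * y - x ≡ q * y * n
    split = solve-∀

  scale-≡ : ∀ k {x y} → x ≡ y ⟨mod n ⟩ → + k * x ≡ + k * y ⟨mod n ℕ.* k ⟩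
  scale-≡ k {x} {y} ⟨ divides q x-y≡qn ⟩ = ⟨ divides q (begin
    + k * x - + k * y    ≡⟨ distrib (+ k) x y ⟩
    + k * (x - y)        ≡⟨ cong (+ k *_) x-y≡qn ⟩
    + k * (q * + n)      ≡⟨ regroup (+ k) q (+ n) ⟩
    q * (+ n * + k)      ≡⟨ cong (q *_) (pos-* n k) ⟨
    q * + (n ℕ.* k)      ∎) ⟩
    where
    open ≡-Reasoning
    distrib : ∀ k x y → k * x - k * y ≡ k * (x - y)
    distrib = solve-∀
    regroup : ∀ k q n → k * (q * n) ≡ q * (n * k)
    regroup = solve-∀

  factor-≡ : ∀ k δ {x m} → x ≡ δ + + k * m ⟨mod n ℕ.* k ⟩ →
             Σ ℤ λ y → (x ≡ δ + + k * y) × (y ≡ m ⟨mod n ⟩)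
  factor-≡ k δ {x} {m} ⟨ divides q eq ⟩ = m + q * + n , (begin
      x                                    ≡⟨ split x (δ + + k * m) ⟩
      x - (δ + + k * m) + (δ + + k * m)    ≡⟨ cong (_+ (δ + + k * m)) eq ⟩
      q * + (n ℕ.* k) + (δ + + k * m)      ≡⟨ cong (λ c → q * c + (δ + + k * m)) (pos-* n k) ⟩
      q * (+ n * + k) + (δ + + k * m)      ≡⟨ regroup δ (+ k) m q (+ n) ⟩
      δ + + k * (m + q * + n)              ∎)
    , ⟨ divides q (cancel m (q * + n)) ⟩
    where
    open ≡-Reasoning
    split : ∀ x e → x ≡ x - e + e
    split = solve-∀
    regroup : ∀ δ k m q n → q * (n * k) + (δ + k * m) ≡ δ + k * (m + q * n)
    regroup = solve-∀
    cancel : ∀ m r → m + r - m ≡ r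
    cancel = solve-∀

⁅_,_⁆ : M2 → M2 → M2
⁅ A , B ⁆ = (A · B) ⊖ (B · A)

group-commutator : M2 → M2 → M2
group-commutator g h = ((g · h) · adj g) · adj h

record Mᴱ (n : ℕ) : Set where
  constructor matᴱ
  field aᴱ bᴱ cᴱ dᴱ : Expr ℤ n

module _ {n : ℕ} where

  infixl 7 _·ᴱ_
  infixl 6 _⊕ₘᴱ_ _⊖ᴱ_

  _·ᴱ_ : Mᴱ n → Mᴱ n → Mᴱ n
  matᴱ a₁ b₁ c₁ d₁ ·ᴱ matᴱ a₂ b₂ c₂ d₂ =
    matᴱ (a₁ ⊗ a₂ ⊕ᴱ b₁ ⊗ c₂) (a₁ ⊗ b₂ ⊕ᴱ b₁ ⊗ d₂)
         (c₁ ⊗ a₂ ⊕ᴱ d₁ ⊗ c₂) (c₁ ⊗ b₂ ⊕ᴱ d₁ ⊗ d₂)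

  _⊕ₘᴱ_ : Mᴱ n → Mᴱ n → Mᴱ n
  matᴱ a₁ b₁ c₁ d₁ ⊕ₘᴱ matᴱ a₂ b₂ c₂ d₂ = matᴱ (a₁ ⊕ᴱ a₂) (b₁ ⊕ᴱ b₂) (c₁ ⊕ᴱ c₂) (d₁ ⊕ᴱ d₂)

  _⊖ᴱ_ : Mᴱ n → Mᴱ n → Mᴱ n
  matᴱ a₁ b₁ c₁ d₁ ⊖ᴱ matᴱ a₂ b₂ c₂ d₂ =
    matᴱ (a₁ ⊕ᴱ ⊝ a₂) (b₁ ⊕ᴱ ⊝ b₂) (c₁ ⊕ᴱ ⊝ c₂) (d₁ ⊕ᴱ ⊝ d₂)

  _⋆ᴱ_ : Expr ℤ n → Mᴱ n → Mᴱ n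
  k ⋆ᴱ matᴱ a₁ b₁ c₁ d₁ = matᴱ (k ⊗ a₁) (k ⊗ b₁) (k ⊗ c₁) (k ⊗ d₁)

  ⁅_,_⁆ᴱ : Mᴱ n → Mᴱ n → Mᴱ n
  ⁅ A , B ⁆ᴱ = (A ·ᴱ B) ⊖ᴱ (B ·ᴱ A)

  Iᴱ : Mᴱ n
  Iᴱ = matᴱ (Κ 1ℤ) (Κ 0ℤ) (Κ 0ℤ) (Κ 1ℤ)

  adjᴱ : Mᴱ n → Mᴱ n
  adjᴱ (matᴱ a₁ b₁ c₁ d₁) = matᴱ d₁ (⊝ b₁) (⊝ c₁) a₁

  detᴱ : Mᴱ n → Expr ℤ n
  detᴱ (matᴱ a₁ b₁ c₁ d₁) = a₁ ⊗ d₁ ⊕ᴱ ⊝ (b₁ ⊗ c₁)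

  trᴱ : Mᴱ n → Expr ℤ n
  trᴱ (matᴱ a₁ b₁ c₁ d₁) = a₁ ⊕ᴱ d₁

  varᴱ : Fin n → Fin n → Fin n → Fin n → Mᴱ n
  varᴱ i j k l = matᴱ (Ι i) (Ι j) (Ι k) (Ι l)

  ⟦_⟧ₘ : Mᴱ n → Vec ℤ n → M2
  ⟦ matᴱ a₁ b₁ c₁ d₁ ⟧ₘ ρ = mat (Ops.⟦ a₁ ⟧ ρ) (Ops.⟦ b₁ ⟧ ρ) (Ops.⟦ c₁ ⟧ ρ) (Ops.⟦ d₁ ⟧ ρ)

  ⟦_⇓⟧ₘ : Mᴱ n → Vec ℤ n → M2
  ⟦ matᴱ a₁ b₁ c₁ d₁ ⇓⟧ₘ ρ = mat (Ops.⟦ a₁ ⇓⟧ ρ) (Ops.⟦ b₁ ⇓⟧ ρ) (Ops.⟦ c₁ ⇓⟧ ρ) (Ops.⟦ d₁ ⇓⟧ ρ)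

  correctₘ : ∀ L ρ → ⟦ L ⇓⟧ₘ ρ ≡ ⟦ L ⟧ₘ ρ
  correctₘ (matᴱ a₁ b₁ c₁ d₁) ρ with Ops.correct a₁ ρ | Ops.correct b₁ ρ | Ops.correct c₁ ρ | Ops.correct d₁ ρ
  ... | p | q | r | s rewrite p | q | r | s = refl

  -- The hypothesis compares normal forms, so it is discharged by refl.
  matrix-identity : ∀ L R ρ → ⟦ L ⇓⟧ₘ ρ ≡ ⟦ R ⇓⟧ₘ ρ → ⟦ L ⟧ₘ ρ ≡ ⟦ R ⟧ₘ ρ
  matrix-identity L R ρ eq = trans (sym (correctₘ L ρ)) (trans eq (correctₘ R ρ))

⋆-·-assoc : ∀ k A B → (k ⋆ A) · B ≡ k ⋆ (A · B)
⋆-·-assoc k (mat a₁ b₁ c₁ d₁) (mat a₂ b₂ c₂ d₂) =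
  matrix-identity ((κ ⋆ᴱ A) ·ᴱ B) (κ ⋆ᴱ (A ·ᴱ B)) (k ∷ a₁ ∷ b₁ ∷ c₁ ∷ d₁ ∷ a₂ ∷ b₂ ∷ c₂ ∷ d₂ ∷ []) refl
  where
  κ = Ι (# 0)
  A = varᴱ (# 1) (# 2) (# 3) (# 4)
  B = varᴱ (# 5) (# 6) (# 7) (# 8)

·-identityʳ : ∀ A → A · I₂ ≡ A
·-identityʳ (mat a₁ b₁ c₁ d₁) = matrix-identity (A ·ᴱ Iᴱ) A (a₁ ∷ b₁ ∷ c₁ ∷ d₁ ∷ []) refl
  where A = varᴱ (# 0) (# 1) (# 2) (# 3)

⊕-⋆-zeroʳ : ∀ A B → A ⊕ (0ℤ ⋆ B) ≡ A
⊕-⋆-zeroʳ (mat a₁ b₁ c₁ d₁) (mat a₂ b₂ c₂ d₂) =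
  matrix-identity (A ⊕ₘᴱ (Κ 0ℤ ⋆ᴱ B)) A (a₁ ∷ b₁ ∷ c₁ ∷ d₁ ∷ a₂ ∷ b₂ ∷ c₂ ∷ d₂ ∷ []) refl
  where
  A = varᴱ (# 0) (# 1) (# 2) (# 3)
  B = varᴱ (# 4) (# 5) (# 6) (# 7)

⁅⁆-unipotent : ∀ e f X Y → ⁅ I₂ ⊕ (e ⋆ X) , I₂ ⊕ (f ⋆ Y) ⁆ ≡ (e * f) ⋆ ⁅ X , Y ⁆
⁅⁆-unipotent e f (mat a₁ b₁ c₁ d₁) (mat a₂ b₂ c₂ d₂) =
  matrix-identity ⁅ Iᴱ ⊕ₘᴱ (ε ⋆ᴱ X) , Iᴱ ⊕ₘᴱ (φ ⋆ᴱ Y) ⁆ᴱ ((ε ⊗ φ) ⋆ᴱ ⁅ X , Y ⁆ᴱ)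
    (e ∷ f ∷ a₁ ∷ b₁ ∷ c₁ ∷ d₁ ∷ a₂ ∷ b₂ ∷ c₂ ∷ d₂ ∷ []) refl
  where
  ε = Ι (# 0)
  φ = Ι (# 1)
  X = varᴱ (# 2) (# 3) (# 4) (# 5)
  Y = varᴱ (# 6) (# 7) (# 8) (# 9)

group-commutator-expansion : ∀ g h → group-commutator g h ≡
  (I₂ ⊕ (⁅ g , h ⁆ · (adj g · adj h))) ⊕ ((det g * det h - 1ℤ) ⋆ I₂)
group-commutator-expansion (mat a₁ b₁ c₁ d₁) (mat a₂ b₂ c₂ d₂) =
  matrix-identity (((g ·ᴱ h) ·ᴱ adjᴱ g) ·ᴱ adjᴱ h)
    ((Iᴱ ⊕ₘᴱ (⁅ g , h ⁆ᴱ ·ᴱ (adjᴱ g ·ᴱ adjᴱ h))) ⊕ₘᴱ ((detᴱ g ⊗ detᴱ h ⊕ᴱ ⊝ Κ 1ℤ) ⋆ᴱ Iᴱ))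
    (a₁ ∷ b₁ ∷ c₁ ∷ d₁ ∷ a₂ ∷ b₂ ∷ c₂ ∷ d₂ ∷ []) refl
  where
  g = varᴱ (# 0) (# 1) (# 2) (# 3)
  h = varᴱ (# 4) (# 5) (# 6) (# 7)

group-commutator-unimodular : ∀ g h → det g ≡ 1ℤ → det h ≡ 1ℤ →
  group-commutator g h ≡ I₂ ⊕ (⁅ g , h ⁆ · (adj g · adj h))
group-commutator-unimodular g h det-g≡1 det-h≡1 = begin
  group-commutator g h             ≡⟨ group-commutator-expansion g h ⟩
  U ⊕ ((det g * det h - 1ℤ) ⋆ I₂)  ≡⟨ cong₂ (λ x y → U ⊕ ((x * y - 1ℤ) ⋆ I₂)) det-g≡1 det-h≡1 ⟩
  U ⊕ (0ℤ ⋆ I₂)                    ≡⟨ ⊕-⋆-zeroʳ U I₂ ⟩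
  U                                ∎
  where
  open ≡-Reasoning
  U = I₂ ⊕ (⁅ g , h ⁆ · (adj g · adj h))

tr-⁅⁆ : ∀ A B → tr ⁅ A , B ⁆ ≡ 0ℤ
tr-⁅⁆ (mat a₁ b₁ c₁ d₁) (mat a₂ b₂ c₂ d₂) =
  Ops.prove (a₁ ∷ b₁ ∷ c₁ ∷ d₁ ∷ a₂ ∷ b₂ ∷ c₂ ∷ d₂ ∷ []) (trᴱ ⁅ A , B ⁆ᴱ) (Κ 0ℤ) refl
  where
  A = varᴱ (# 0) (# 1) (# 2) (# 3)
  B = varᴱ (# 4) (# 5) (# 6) (# 7)

infix 4 _≡ₘ_⟨mod_⟩

record _≡ₘ_⟨mod_⟩ (A B : M2) (n : ℕ) : Set where
  constructor entrywise
  field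
    a≡ : a A ≡ a B ⟨mod n ⟩
    b≡ : b A ≡ b B ⟨mod n ⟩
    c≡ : c A ≡ c B ⟨mod n ⟩
    d≡ : d A ≡ d B ⟨mod n ⟩

module _ {n : ℕ} where

  from-≡ₘ : ∀ A B → A ≡ₘ B [mod n ] → A ≡ₘ B ⟨mod n ⟩
  from-≡ₘ _ _ (a≡ , b≡ , c≡ , d≡) = entrywise ⟨ ∣ᵤ⇒∣ a≡ ⟩ ⟨ ∣ᵤ⇒∣ b≡ ⟩ ⟨ ∣ᵤ⇒∣ c≡ ⟩ ⟨ ∣ᵤ⇒∣ d≡ ⟩

  to-≡ₘ : ∀ {A B} → A ≡ₘ B ⟨mod n ⟩ → A ≡ₘ B [mod n ]
  to-≡ₘ (entrywise ⟨ a≡ ⟩ ⟨ b≡ ⟩ ⟨ c≡ ⟩ ⟨ d≡ ⟩) = ∣⇒∣ᵤ a≡ , ∣⇒∣ᵤ b≡ , ∣⇒∣ᵤ c≡ , ∣⇒∣ᵤ d≡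

  ≡ₘ-refl : ∀ A → A ≡ₘ A ⟨mod n ⟩
  ≡ₘ-refl A = entrywise (≡-refl (a A)) (≡-refl (b A)) (≡-refl (c A)) (≡-refl (d A))

  ⊕-congₘ : ∀ {A A′ B B′} → A ≡ₘ A′ ⟨mod n ⟩ → B ≡ₘ B′ ⟨mod n ⟩ → A ⊕ B ≡ₘ A′ ⊕ B′ ⟨mod n ⟩
  ⊕-congₘ (entrywise a≡ b≡ c≡ d≡) (entrywise a≡′ b≡′ c≡′ d≡′) =
    entrywise (+-cong a≡ a≡′) (+-cong b≡ b≡′) (+-cong c≡ c≡′) (+-cong d≡ d≡′)

  ⊖-congₘ : ∀ {A A′ B B′} → A ≡ₘ A′ ⟨mod n ⟩ → B ≡ₘ B′ ⟨mod n ⟩ → A ⊖ B ≡ₘ A′ ⊖ B′ ⟨mod n ⟩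
  ⊖-congₘ (entrywise a≡ b≡ c≡ d≡) (entrywise a≡′ b≡′ c≡′ d≡′) =
    entrywise (+-cong a≡ (-‿cong a≡′)) (+-cong b≡ (-‿cong b≡′))
              (+-cong c≡ (-‿cong c≡′)) (+-cong d≡ (-‿cong d≡′))

  ·-congₘ : ∀ {A A′ B B′} → A ≡ₘ A′ ⟨mod n ⟩ → B ≡ₘ B′ ⟨mod n ⟩ → A · B ≡ₘ A′ · B′ ⟨mod n ⟩
  ·-congₘ (entrywise a≡ b≡ c≡ d≡) (entrywise a≡′ b≡′ c≡′ d≡′) =
    entrywise (+-cong (*-cong a≡ a≡′) (*-cong b≡ c≡′)) (+-cong (*-cong a≡ b≡′) (*-cong b≡ d≡′))
              (+-cong (*-cong c≡ a≡′) (*-cong d≡ c≡′)) (+-cong (*-cong c≡ b≡′) (*-cong d≡ d≡′))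

  ⁅⁆-congₘ : ∀ {A A′ B B′} → A ≡ₘ A′ ⟨mod n ⟩ → B ≡ₘ B′ ⟨mod n ⟩ → ⁅ A , B ⁆ ≡ₘ ⁅ A′ , B′ ⁆ ⟨mod n ⟩
  ⁅⁆-congₘ A≡ B≡ = ⊖-congₘ (·-congₘ A≡ B≡) (·-congₘ B≡ A≡)

  adj-congₘ : ∀ {A B} → A ≡ₘ B ⟨mod n ⟩ → adj A ≡ₘ adj B ⟨mod n ⟩
  adj-congₘ (entrywise a≡ b≡ c≡ d≡) = entrywise d≡ (-‿cong b≡) (-‿cong c≡) a≡

  unipotent-≡ₘ-I₂ : ∀ {e} → n ∣ e → ∀ X → I₂ ⊕ ((+ e) ⋆ X) ≡ₘ I₂ ⟨mod n ⟩
  unipotent-≡ₘ-I₂ n∣e X = entrywise (+-multiple-≡ n∣e 1ℤ (a X)) (+-multiple-≡ n∣e 0ℤ (b X))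
                                    (+-multiple-≡ n∣e 0ℤ (c X)) (+-multiple-≡ n∣e 1ℤ (d X))

  scale-≡ₘ : ∀ k {A B} → A ≡ₘ B ⟨mod n ⟩ → (+ k) ⋆ A ≡ₘ (+ k) ⋆ B ⟨mod n ℕ.* k ⟩
  scale-≡ₘ k (entrywise a≡ b≡ c≡ d≡) =
    entrywise (scale-≡ k a≡) (scale-≡ k b≡) (scale-≡ k c≡) (scale-≡ k d≡)

  factor-≡ₘ : ∀ k {γ M} → γ ≡ₘ I₂ ⊕ ((+ k) ⋆ M) ⟨mod n ℕ.* k ⟩ →
              Σ M2 λ X → (γ ≡ I₂ ⊕ ((+ k) ⋆ X)) × (X ≡ₘ M ⟨mod n ⟩)
  factor-≡ₘ k {mat _ _ _ _} (entrywise a≡ b≡ c≡ d≡)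
    with factor-≡ k 1ℤ a≡ | factor-≡ k 0ℤ b≡ | factor-≡ k 0ℤ c≡ | factor-≡ k 1ℤ d≡
  ... | x₁ , refl , x₁≡ | x₂ , refl , x₂≡ | x₃ , refl , x₃≡ | x₄ , refl , x₄≡ =
    mat x₁ x₂ x₃ x₄ , refl , entrywise x₁≡ x₂≡ x₃≡ x₄≡

group-commutator-≡ₘ : ∀ {n e f γ₁ γ₂ M₁ M₂} → n ∣ e → n ∣ f → det γ₁ ≡ 1ℤ → det γ₂ ≡ 1ℤ →
  γ₁ ≡ₘ I₂ ⊕ ((+ e) ⋆ M₁) ⟨mod n ℕ.* e ⟩ → γ₂ ≡ₘ I₂ ⊕ ((+ f) ⋆ M₂) ⟨mod n ℕ.* f ⟩ →
  group-commutator γ₁ γ₂ ≡ₘ I₂ ⊕ ((+ (e ℕ.* f)) ⋆ ⁅ M₁ , M₂ ⁆) ⟨mod n ℕ.* (e ℕ.* f) ⟩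
group-commutator-≡ₘ {n} {e} {f} {γ₁} {γ₂} {M₁} {M₂} n∣e n∣f det-γ₁≡1 det-γ₂≡1 γ₁≡ γ₂≡
  with factor-≡ₘ e γ₁≡ | factor-≡ₘ f γ₂≡
... | X , refl , X≡M₁ | Y , refl , Y≡M₂ =
  subst (λ C → C ≡ₘ I₂ ⊕ ((+ (e ℕ.* f)) ⋆ ⁅ M₁ , M₂ ⁆) ⟨mod n ℕ.* (e ℕ.* f) ⟩) (sym expansion)
    (⊕-congₘ (≡ₘ-refl I₂) (scale-≡ₘ (e ℕ.* f) bracket≡))
  where
  W = adj γ₁ · adj γ₂

  expansion : group-commutator γ₁ γ₂ ≡ I₂ ⊕ ((+ (e ℕ.* f)) ⋆ (⁅ X , Y ⁆ · W))
  expansion = begin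
    group-commutator γ₁ γ₂                ≡⟨ group-commutator-unimodular γ₁ γ₂ det-γ₁≡1 det-γ₂≡1 ⟩
    I₂ ⊕ (⁅ γ₁ , γ₂ ⁆ · W)                ≡⟨ cong (λ Z → I₂ ⊕ (Z · W)) (⁅⁆-unipotent (+ e) (+ f) X Y) ⟩
    I₂ ⊕ (((+ e * + f) ⋆ ⁅ X , Y ⁆) · W)  ≡⟨ cong (I₂ ⊕_) (⋆-·-assoc (+ e * + f) ⁅ X , Y ⁆ W) ⟩
    I₂ ⊕ ((+ e * + f) ⋆ (⁅ X , Y ⁆ · W))  ≡⟨ cong (λ k → I₂ ⊕ (k ⋆ (⁅ X , Y ⁆ · W))) (pos-* e f) ⟨
    I₂ ⊕ ((+ (e ℕ.* f)) ⋆ (⁅ X , Y ⁆ · W))  ∎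
    where open ≡-Reasoning

  bracket≡ : ⁅ X , Y ⁆ · W ≡ₘ ⁅ M₁ , M₂ ⁆ ⟨mod n ⟩
  bracket≡ = subst (λ B → ⁅ X , Y ⁆ · W ≡ₘ B ⟨mod n ⟩) (·-identityʳ ⁅ M₁ , M₂ ⁆)
    (·-congₘ (⁅⁆-congₘ X≡M₁ Y≡M₂)
      (·-congₘ (adj-congₘ (unipotent-≡ₘ-I₂ n∣e X)) (adj-congₘ (unipotent-≡ₘ-I₂ n∣f Y))))

group-commutator-∈ : ∀ {p Γ} → IsCongruenceSubgroupPPower p Γ →
  ∀ {g h} → Γ g → Γ h → Γ (group-commutator g h)
group-commutator-∈ Γ-subgroup g∈Γ h∈Γ =
  closed-· _ _ (closed-· _ _ (closed-· _ _ g∈Γ h∈Γ) (closed-⁻¹ _ g∈Γ)) (closed-⁻¹ _ h∈Γ)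
  where open IsCongruenceSubgroupPPower Γ-subgroup

⁅⁆-∈-sl₂ : ∀ p A B → sl₂𝔽 p ⁅ A , B ⁆
⁅⁆-∈-sl₂ p A B = subst (λ t → t ≡ 0ℤ [mod p ]) (sym (tr-⁅⁆ A B)) (p ∣0)

proposition4p6 : (p : ℕ) → Prime p → (Γ : M2 → Set) → IsCongruenceSubgroupPPower p Γ →
    (s₁ s₂ : ℕ) → s₁ ≥ 1 → s₂ ≥ 1 → (M₁ M₂ : M2) →
    V p Γ s₁ M₁ → V p Γ s₂ M₂ → V p Γ (s₁ ℕ.+ s₂) ((M₁ · M₂) ⊖ (M₂ · M₁))
proposition4p6 p _ Γ Γ-subgroup s₁@(suc _) s₂@(suc _) (s≤s z≤n) (s≤s z≤n) M₁ M₂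
  (_ , γ₁ , γ₁∈Γ , γ₁≡) (_ , γ₂ , γ₂∈Γ , γ₂≡) =
  ⁅⁆-∈-sl₂ p M₁ M₂ ,
  group-commutator γ₁ γ₂ ,
  group-commutator-∈ Γ-subgroup γ₁∈Γ γ₂∈Γ ,
  to-≡ₘ (subst (λ k → group-commutator γ₁ γ₂ ≡ₘ I₂ ⊕ ((+ k) ⋆ ⁅ M₁ , M₂ ⁆) ⟨mod p ℕ.* k ⟩)
    (sym (^-distribˡ-+-* p s₁ s₂))
    (group-commutator-≡ₘ {p} {p ℕ.^ s₁} {p ℕ.^ s₂} (m∣m*n _) (m∣m*n _) (⊆SL₂ γ₁ γ₁∈Γ) (⊆SL₂ γ₂ γ₂∈Γ)
      (from-≡ₘ γ₁ (I₂ ⊕ ((+ (p ℕ.^ s₁)) ⋆ M₁)) γ₁≡) (from-≡ₘ γ₂ (I₂ ⊕ ((+ (p ℕ.^ s₂)) ⋆ M₂)) γ₂≡)))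
  where open IsCongruenceSubgroupPPower Γ-subgroup
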